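{- Let $T$ be a tableau and $x,y$ distinct elements not among the labels of $T$. Assume that the column trail of $x\to T$ and the row trail of $T\leftarrow y$ have a (unique) common box $S$ which is a box of $T$, with label $s$. Let $B$ (resp. $J$) be the box following $S$ in the column trail of $x\to T$ (resp. row trail of $T\leftarrow y$); it may be the empty box of that trail. Let $a$ be the label of the box preceding $S$ in the column trail, or $a=x$ if $S$ is the first box of the column trail; let $i$ be the label of the box preceding $S$ in the row trail, or $i=y$ if $S$ is the first box of the row trail. Then in the tableau $(x\to T)\leftarrow y$: (1) the labels of $S,B,J$ are respectively $i,s,a$ if $i<a$, and $a,i,s$ if $i>a$; (2) all other labels are obtained by sliding the labels of the two trails, other than $i,a,s$, each to the next box of its trail: every box not on either trail keeps its label from $T$; the first box of the column trail, if different from $S$, receives $x$; the first box of the row trail, if different from $S$, receives $y$; and every other box of either trail, distinct from $S,B,J$, receives the label in $T$ of the box preceding it on its trail.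
   Context: Tableaux use the French convention: a tableau $T$ is a finite lower order ideal $D$ (componentwise order) of boxes $(c,r)\in\{1,2,\dots\}^2$ ($c$ = column, $r$ = row, row $1$ at the bottom), with an injective labelling by a totally ordered set, strictly increasing to the right along rows and upward along columns. Row insertion of $x$ into a row $L$ ($x\notin L$): if $L$ is empty or $x>\max L$, append $x$; otherwise replace the smallest $z\in L$ with $z>x$ by $x$, and $z$ is bumped. $T\leftarrow x$ inserts $x$ into row $1$, then the bumped element into row $2$, etc., until nothing is bumped (the last element occupies a new box at the end of its row). Column insertion $x\to T$ is defined symmetrically with columns (column $1$ leftmost). The row trail of $T\leftarrow x$ is the sequence of boxes of $T$ whose labels are bumped, in order, each with its label in $T$, followed by the newly created box (the empty box of the trail, not in $T$). The column trail of $x\to T$ is defined symmetrically. The tableau $T\leftarrow x$ is obtained from $T$ by moving each label on the trail to the next box of the trail and placing $x$ in the first box; similarly for $x\to T$. -}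

module Defs where

open import Level using (Level)
open import Relation.Binary.Core using (Rel)
open import Relation.Binary.Structures using (IsStrictTotalOrder)
open import Relation.Binary.PropositionalEquality using (_≡_; _≢_)
open import Data.Nat as ℕ using (ℕ; zero; suc; _≤_)
open import Data.Product using (_×_; _,_; proj₁; proj₂; map₁)
open import Data.Maybe using (Maybe; just; nothing; _>>=_)
open import Data.List using (List; []; _∷_; [_]; length; map; mapMaybe; upTo; zip; _++_)
open import Data.List.Relation.Unary.All using (All)
open import Relation.Binary.Definitions using (tri<; tri≈; tri>)

module Tableaux {a ℓ : Level} {A : Set a} {_<_ : Rel A ℓ}
                (sto : IsStrictTotalOrder _≡_ _<_) where


  open IsStrictTotalOrder sto using (compare)

  -- A box (c , r): c = column, r = row, both starting at 1 (row 1 at the bottom).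
  Box : Set
  Box = ℕ × ℕ

  -- A tableau is stored as the list of its rows, row 1 first, each row listed
  -- left to right.
  Tab : Set a
  Tab = List (List A)

  lookupIdx : ∀ {b} {X : Set b} → List X → ℕ → Maybe X
  lookupIdx []       _       = nothing
  lookupIdx (x ∷ _)  zero    = just x
  lookupIdx (_ ∷ xs) (suc n) = lookupIdx xs n

  lab : Tab → Box → Maybe A
  lab T (zero  , _)     = nothing
  lab T (suc _ , zero)  = nothing
  lab T (suc c , suc r) = lookupIdx T r >>= λ L → lookupIdx L c

  InT : Tab → Box → Set a
  InT T D = Data.Product.Σ A (λ w → lab T D ≡ just w)

  record IsTableau (T : Tab) : Set (a Level.⊔ ℓ) where
    field
      rowsNonempty : All (λ L → L ≢ []) T
      lowerIdeal   : ∀ c r c' r' u → 1 ≤ c' → 1 ≤ r' → c' ≤ c → r' ≤ r →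
                     lab T (c , r) ≡ just u → InT T (c' , r')
      rowIncr      : ∀ c r u v → lab T (c , r) ≡ just u →
                     lab T (suc c , r) ≡ just v → u < v
      colIncr      : ∀ c r u v → lab T (c , r) ≡ just u →
                     lab T (c , suc r) ≡ just v → u < v
      injective    : ∀ D D' u → lab T D ≡ just u → lab T D' ≡ just u → D ≡ D'

  NotLabel : A → Tab → Set a
  NotLabel x T = ∀ D → lab T D ≢ just x

  -- Insertion of x into a row L: returns the new row and, if some z was bumped,
  -- its (1-based) column position and z.  (In a row, which is increasing, the
  -- first element > x is the smallest element > x.)
  insRow : A → List A → List A × Maybe (ℕ × A)
  insRow x [] = [ x ] , nothing
  insRow x (z ∷ L) with compare x z
  ... | tri< _ _ _ = x ∷ L , just (1 , z)
  ... | tri≈ _ _ _ = z ∷ proj₁ (insRow x L) , Data.Maybe.map (map₁ suc) (proj₂ (insRow x L))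
  ... | tri> _ _ _ = z ∷ proj₁ (insRow x L) , Data.Maybe.map (map₁ suc) (proj₂ (insRow x L))

  -- A trail: the boxes of T whose labels are bumped, in order, each with its
  -- label in T, followed by the newly created (empty) box.
  Trail : Set a
  Trail = List (Box × A) × Box

  insFrom : ℕ → A → Tab → Tab × Trail
  insFrom r x [] = [ x ] ∷ [] , [] , (1 , r)
  insFrom r x (L ∷ Ls) with insRow x L
  ... | L' , nothing = L' ∷ Ls , [] , (suc (length L) , r)
  ... | L' , just (c , z) with insFrom (suc r) z Ls
  ...   | Ls' , tr , e = L' ∷ Ls' , ((c , r) , z) ∷ tr , e

  rowInsert : Tab → A → Tab
  rowInsert T x = proj₁ (insFrom 1 x T)

  rowTrail : Tab → A → Trail
  rowTrail T x = proj₂ (insFrom 1 x T)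

  transpose : Tab → Tab
  transpose []         = []
  transpose (L ∷ Ls)   =
    map (λ c → mapMaybe (λ R → lookupIdx R c) (L ∷ Ls)) (upTo (length L))

  swapBox : Box → Box
  swapBox (c , r) = r , c

  colInsert : A → Tab → Tab
  colInsert x T = transpose (rowInsert (transpose T) x)

  colTrail : A → Tab → Trail
  colTrail x T with rowTrail (transpose T) x
  ... | tr , e = map (map₁ swapBox) tr , swapBox e

  trailBoxes : Trail → List Box
  trailBoxes (tr , e) = map proj₁ tr ++ [ e ]

  nextBox : List (Box × A) → Box → Box
  nextBox []            e = e
  nextBox ((b , _) ∷ _) e = b

  prevLabel : A → List (Box × A) → A
  prevLabel x []             = x
  prevLabel _ ((_ , u) ∷ us) = prevLabel u us

  -- the sliding of labels along a trail when inserting x: the first box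
  -- receives x, every other box receives the T-label of its predecessor.
  slide : A → Trail → List (Box × A)
  slide x (tr , e) = zip (map proj₁ tr ++ [ e ]) (x ∷ map proj₂ tr)

{-# OPTIONS --safe #-}
-- In x → T labels only decrease, and only along the column trail, which meets the row trail
-- of T ← y in S alone.  So when y is inserted into x → T, the bumped values travel as in
-- T ← y until i reaches the row of S, where S now holds a instead of s.  If i < a, then i
-- bumps a, and a continues along the old row trail: it still lands in J, because the boxes
-- left of J in the row above S lie south-west of the predecessor of S on the column trail and
-- so carry labels below a.  If a < i, then i passes S and bumps s out of B, which lies
-- directly right of S, and s continues along the old row trail.  To make this precise, an
-- insertion trail is characterised by labels alone (each value lands in the first box of its
-- line that is empty or holds a larger label); the candidate trail in x → T is checked
-- against this characterisation, and the labels are read off from the fact that insertion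
-- slides labels along its trail.

module Submission where

open import Defs
open import Level using (Level; _⊔_)
open import Function using (_∘_)
open import Relation.Binary.Core using (Rel)
open import Relation.Binary.Structures using (IsStrictTotalOrder)
open import Relation.Binary.Definitions using (tri<; tri≈; tri>)
open import Relation.Binary.PropositionalEquality
  using (_≡_; _≢_; refl; sym; trans; cong; cong₂; subst; module ≡-Reasoning)
open import Relation.Nullary using (¬_; Dec; yes; no; contradiction)
open import Data.Sum using (_⊎_; inj₁; inj₂; [_,_]′)
open import Data.Product using (Σ; _×_; _,_; proj₁; proj₂; map₁; map₂)
open import Data.Product.Properties using (≡-dec)
open import Data.Nat as ℕ using (ℕ; zero; suc; _+_; z≤n; s≤s)
import Data.Nat.Properties as ℕ
open import Data.Maybe as Maybe using (Maybe; just; nothing)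
open import Data.Maybe.Properties using (just-injective)
open import Data.List
  using (List; []; _∷_; [_]; _++_; _∷ʳ_; _∷ʳ′_; initLast; length; map; mapMaybe; applyUpTo)
open import Data.List.Properties using (map-upTo; length-applyUpTo; map-++; ++-assoc; ∷ʳ-++; length-++)
open import Data.List.Relation.Unary.Any using (here; there)
open import Data.List.Membership.Propositional using (_∈_; _∉_)
open import Data.List.Membership.Propositional.Properties using (∈-map⁺; ∈-map⁻; ∈-++⁺ˡ; ∈-++⁺ʳ; ∈-++⁻)
import Data.List.Membership.DecPropositional as DecMembership

module InsertionTrails {ℓa ℓ : Level} {A : Set ℓa} {_<_ : Rel A ℓ}
                       (sto : IsStrictTotalOrder _≡_ _<_) where
  open Tableaux sto
  open IsStrictTotalOrder sto using (compare; irrefl; asym) renaming (trans to <-trans)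

  just≢nothing : ∀ {w : A} → just w ≢ nothing
  just≢nothing ()

  _≼_ : A → A → Set (ℓa ⊔ ℓ)
  u ≼ v = u ≡ v ⊎ u < v

  ≼-<-trans : ∀ {u v w} → u ≼ v → v < w → u < w
  ≼-<-trans (inj₁ refl) v<w = v<w
  ≼-<-trans (inj₂ u<v)  v<w = <-trans u<v v<w

  <-≼-trans : ∀ {u v w} → u < v → v ≼ w → u < w
  <-≼-trans u<v (inj₁ refl) = u<v
  <-≼-trans u<v (inj₂ v<w)  = <-trans u<v v<w

  lab-[] : ∀ D → lab [] D ≡ nothing
  lab-[] (zero  , r)     = refl
  lab-[] (suc c , zero)  = refl
  lab-[] (suc c , suc r) = refl

  lab-∷ : ∀ L Ls c k → lab (L ∷ Ls) (c , suc (suc k)) ≡ lab Ls (c , suc k)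
  lab-∷ L Ls zero    k = refl
  lab-∷ L Ls (suc c) k = refl

  lab-≥1 : ∀ X c r {u} → lab X (c , r) ≡ just u → 1 ℕ.≤ c × 1 ℕ.≤ r
  lab-≥1 X (suc c) (suc r) _ = s≤s z≤n , s≤s z≤n

  lookupIdx-leftClosed : ∀ (L : List A) {j j'} → j ℕ.≤ j' → Σ A (λ w → lookupIdx L j' ≡ just w) →
                         Σ A λ w → lookupIdx L j ≡ just w
  lookupIdx-leftClosed (u ∷ L) {zero}          _         _ = u , refl
  lookupIdx-leftClosed (u ∷ L) {suc j} {suc j'} (s≤s j≤j') l = lookupIdx-leftClosed L j≤j' l

  lab-leftClosed : ∀ X {c c' r} → 1 ℕ.≤ c → c ℕ.≤ c' → InT X (c' , r) → InT X (c , r)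
  lab-leftClosed X {suc c} {suc c'} {suc r} _ (s≤s c≤c') (w , lw) with lookupIdx X r
  ... | just L = lookupIdx-leftClosed L c≤c' (w , lw)

  -- `transpose` compacts every column, so it preserves labels only when columns have no gaps.
  DownClosed : Tab → Set ℓa
  DownClosed X = ∀ c r u → lab X (suc c , suc (suc r)) ≡ just u → InT X (suc c , suc r)

  lookupIdx-beyond : ∀ {b} {B : Set b} (L : List B) {r} → length L ℕ.≤ r → lookupIdx L r ≡ nothing
  lookupIdx-beyond []      _       = refl
  lookupIdx-beyond (_ ∷ L) (s≤s p) = lookupIdx-beyond L p

  lookupIdx-applyUpTo : ∀ {b} {B : Set b} (h : ℕ → B) {n r} → r ℕ.< n →
                        lookupIdx (applyUpTo h n) r ≡ just (h r)
  lookupIdx-applyUpTo h {suc n} {zero}  _       = refl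
  lookupIdx-applyUpTo h {suc n} {suc r} (s≤s p) = lookupIdx-applyUpTo (h ∘ suc) p

  column-empty : ∀ X → DownClosed X → ∀ {c} → lab X (suc c , 1) ≡ nothing →
                 ∀ r → lab X (suc c , suc r) ≡ nothing
  column-empty X closed e zero = e
  column-empty X closed {c} e (suc r) with lab X (suc c , suc (suc r)) in eq
  ... | nothing = refl
  ... | just u  = contradiction (trans (sym (proj₂ (closed c r u eq))) (column-empty X closed e r)) just≢nothing

  columnOf : Tab → ℕ → List A
  columnOf X c = mapMaybe (λ R → lookupIdx R c) X

  lookupIdx-column : ∀ X → DownClosed X → ∀ c r → lookupIdx (columnOf X c) r ≡ lab X (suc c , suc r)
  lookupIdx-column []       closed c r = refl
  lookupIdx-column (R ∷ Rs) closed c r with lookupIdx R c in e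
  ... | just w  with r
  ...   | zero  = sym e
  ...   | suc r = lookupIdx-column Rs (λ c r → closed c (suc r)) c r
  lookupIdx-column (R ∷ Rs) closed c r | nothing =
    trans (lookupIdx-column Rs (λ c r → closed c (suc r)) c r)
          (trans (column-empty (R ∷ Rs) closed e (suc r)) (sym (column-empty (R ∷ Rs) closed e r)))

  lab-transpose : ∀ X → DownClosed X → ∀ D → lab (transpose X) D ≡ lab X (swapBox D)
  lab-transpose X        closed (zero  , zero)  = refl
  lab-transpose X        closed (zero  , suc r) = refl
  lab-transpose X        closed (suc c , zero)  = refl
  lab-transpose []       closed (suc c , suc r) = refl
  lab-transpose (L ∷ Ls) closed (suc c , suc r)
    rewrite map-upTo (columnOf (L ∷ Ls)) (length L) with r ℕ.<? length L
  ... | yes r<n rewrite lookupIdx-applyUpTo (columnOf (L ∷ Ls)) r<n = lookupIdx-column (L ∷ Ls) closed r c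
  ... | no r≮n
    rewrite lookupIdx-beyond (applyUpTo (columnOf (L ∷ Ls)) (length L))
              (ℕ.≤-trans (ℕ.≤-reflexive (length-applyUpTo _ (length L))) (ℕ.≮⇒≥ r≮n)) =
    sym (column-empty (L ∷ Ls) closed (lookupIdx-beyond L (ℕ.≮⇒≥ r≮n)) c)

  PlacedAt : A → List A → List A → ℕ → Set ℓa
  PlacedAt v L L' n = lookupIdx L' n ≡ just v × (∀ j → j ≢ n → lookupIdx L' j ≡ lookupIdx L j)

  InsRowEffect : A → List A → List A × Maybe (ℕ × A) → Set ℓa
  InsRowEffect v L (L' , nothing)      = PlacedAt v L L' (length L)
  InsRowEffect v L (L' , just (c , z)) = Σ ℕ λ n → c ≡ suc n × lookupIdx L n ≡ just z × PlacedAt v L L' n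

  PlacedAt-∷ : ∀ {v L L' n} z → PlacedAt v L L' n → PlacedAt v (z ∷ L) (z ∷ L') (suc n)
  PlacedAt-∷ z (new , same) = new , λ { zero _ → refl ; (suc j) j≢ → same j (j≢ ∘ cong suc) }

  insRow-effect-∷ : ∀ v z L r → InsRowEffect v L r →
                    InsRowEffect v (z ∷ L) (z ∷ proj₁ r , Maybe.map (map₁ suc) (proj₂ r))
  insRow-effect-∷ v z L (L' , nothing)      placed                = PlacedAt-∷ z placed
  insRow-effect-∷ v z L (L' , just (c , _)) (n , c≡ , old , placed) = suc n , cong suc c≡ , old , PlacedAt-∷ z placed

  insRow-effect : ∀ v L → InsRowEffect v L (insRow v L)
  insRow-effect v [] = refl , λ { zero j≢ → contradiction refl j≢ ; (suc j) _ → refl }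
  insRow-effect v (z ∷ L) with compare v z
  ... | tri< _ _ _ = 0 , refl , refl , refl , λ { zero j≢ → contradiction refl j≢ ; (suc j) _ → refl }
  ... | tri≈ _ _ _ = insRow-effect-∷ v z L (insRow v L) (insRow-effect v L)
  ... | tri> _ _ _ = insRow-effect-∷ v z L (insRow v L) (insRow-effect v L)

  PrefixBelow : A → List A → ℕ → Set (ℓa ⊔ ℓ)
  PrefixBelow v L n = ∀ j → j ℕ.< n → Σ A λ w → lookupIdx L j ≡ just w × w < v

  PrefixBelow-∷ : ∀ {v z L n} → z < v → PrefixBelow v L n → PrefixBelow v (z ∷ L) (suc n)
  PrefixBelow-∷ z<v below zero    _         = _ , refl , z<v
  PrefixBelow-∷ z<v below (suc j) (s≤s j<n) = below j j<n

  PrefixBelow-tail : ∀ {v z L n} → PrefixBelow v (z ∷ L) (suc n) → PrefixBelow v L n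
  PrefixBelow-tail below j j<n = below (suc j) (s≤s j<n)

  InsRowPosition : A → List A → Maybe (ℕ × A) → Set (ℓa ⊔ ℓ)
  InsRowPosition v L nothing        = PrefixBelow v L (length L)
  InsRowPosition v L (just (c , z)) = Σ ℕ λ n → c ≡ suc n × lookupIdx L n ≡ just z × v < z × PrefixBelow v L n

  insRow-position-∷ : ∀ v z L m → z < v → InsRowPosition v L m →
                      InsRowPosition v (z ∷ L) (Maybe.map (map₁ suc) m)
  insRow-position-∷ v z L nothing        z<v below                  = PrefixBelow-∷ z<v below
  insRow-position-∷ v z L (just (c , _)) z<v (n , c≡ , old , v<z , below) =
    suc n , cong suc c≡ , old , v<z , PrefixBelow-∷ z<v below

  insRow-position : ∀ v L → (∀ j → lookupIdx L j ≢ just v) → InsRowPosition v L (proj₂ (insRow v L))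
  insRow-position v []      v∉L = λ _ ()
  insRow-position v (z ∷ L) v∉L with compare v z
  ... | tri< v<z _ _ = 0 , refl , refl , v<z , λ _ ()
  ... | tri≈ _ refl _ = contradiction refl (v∉L 0)
  ... | tri> _ _ z<v = insRow-position-∷ v z L (proj₂ (insRow v L)) z<v (insRow-position v L (v∉L ∘ suc))

  insRow-appends : ∀ v L n → PrefixBelow v L n → lookupIdx L n ≡ nothing →
                   proj₂ (insRow v L) ≡ nothing × length L ≡ n
  insRow-appends v []      zero    below _ = refl , refl
  insRow-appends v []      (suc n) below _ with below 0 (s≤s z≤n)
  ... | _ , () , _
  insRow-appends v (z ∷ L) (suc n) below free with below 0 (s≤s z≤n) | compare v z
  ... | _ , refl , z<v | tri< v<z _ _ = contradiction z<v (asym v<z)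
  ... | _ , refl , z<v | tri≈ _ refl _ = contradiction z<v (irrefl refl)
  ... | _ , refl , z<v | tri> _ _ _ with insRow-appends v L n (PrefixBelow-tail below) free
  ...   | no-bump , len = cong (Maybe.map (map₁ suc)) no-bump , cong suc len

  insRow-bumps : ∀ v L n z → PrefixBelow v L n → lookupIdx L n ≡ just z → v < z →
                 proj₂ (insRow v L) ≡ just (suc n , z)
  insRow-bumps v (z' ∷ L) zero z below refl v<z with compare v z'
  ... | tri< _ _ _    = refl
  ... | tri≈ _ refl _ = contradiction v<z (irrefl refl)
  ... | tri> _ _ z<v  = contradiction z<v (asym v<z)
  insRow-bumps v (z' ∷ L) (suc n) z below old v<z with below 0 (s≤s z≤n) | compare v z'
  ... | _ , refl , z'<v | tri< v<z' _ _ = contradiction z'<v (asym v<z')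
  ... | _ , refl , z'<v | tri≈ _ refl _ = contradiction z'<v (irrefl refl)
  ... | _ , refl , z'<v | tri> _ _ _ =
    cong (Maybe.map (map₁ suc)) (insRow-bumps v L n z (PrefixBelow-tail below) old v<z)

  -- Trails described by labels

  Labelling : Set ℓa
  Labelling = Box → Maybe A

  LabelInjective : Labelling → Set ℓa
  LabelInjective f = ∀ D D' u → f D ≡ just u → f D' ≡ just u → D ≡ D'

  -- `o c r` is the c-th box of the r-th line: of row r for `rowwise`, of column r for `columnwise`.
  Orientation : Set
  Orientation = ℕ → ℕ → Box

  rowwise columnwise : Orientation
  rowwise    c r = c , r
  columnwise c r = r , c

  SmallerBefore : Orientation → Labelling → ℕ → ℕ → A → Set (ℓa ⊔ ℓ)
  SmallerBefore o f pos r v = ∀ c → 1 ℕ.≤ c → c ℕ.< pos → Σ A λ w → f (o c r) ≡ just w × w < v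

  record LandsAt (o : Orientation) (f : Labelling) (r : ℕ) (v : A) (D : Box) : Set (ℓa ⊔ ℓ) where
    constructor landsAt
    field
      pos    : ℕ
      box≡   : D ≡ o pos r
      pos≥1  : 1 ℕ.≤ pos
      before : SmallerBefore o f pos r v

  Bumps : Orientation → Labelling → ℕ → A → Box → A → Set (ℓa ⊔ ℓ)
  Bumps o f r v D z = LandsAt o f r v D × f D ≡ just z × v < z

  ValidTrail : Orientation → Labelling → ℕ → A → Trail → Set (ℓa ⊔ ℓ)
  ValidTrail o f r v ([]           , e) = LandsAt o f r v e × f e ≡ nothing
  ValidTrail o f r v ((D , z) ∷ tr , e) = Bumps o f r v D z × ValidTrail o f (suc r) z (tr , e)

  record RowsFrom (X : Tab) (f : Labelling) (r : ℕ) : Set ℓa where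
    constructor rowsFrom
    field lab≡ : ∀ c k → lab X (c , suc k) ≡ f (c , r + k)

  RowsFrom-head : ∀ {X f r} → RowsFrom X f r → ∀ c → lab X (c , 1) ≡ f (c , r)
  RowsFrom-head {f = f} {r} (rowsFrom rows) c = trans (rows c 0) (cong (λ k → f (c , k)) (ℕ.+-identityʳ r))

  RowsFrom-tail : ∀ {L Ls f r} → RowsFrom (L ∷ Ls) f r → RowsFrom Ls f (suc r)
  RowsFrom-tail {L} {Ls} {f} {r} (rowsFrom rows) = rowsFrom λ c k →
    trans (sym (lab-∷ L Ls c k)) (trans (rows c (suc k)) (cong (λ k → f (c , k)) (ℕ.+-suc r k)))

  RowsFrom-prefixBelow : ∀ {L Ls f r v n} → RowsFrom (L ∷ Ls) f r →
                         SmallerBefore rowwise f (suc n) r v → PrefixBelow v L n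
  RowsFrom-prefixBelow rows before j j<n with before (suc j) (s≤s z≤n) (s≤s j<n)
  ... | w , fw , w<v = w , trans (RowsFrom-head rows (suc j)) fw , w<v

  insFrom-trail : ∀ f r v X → RowsFrom X f r → ∀ t → ValidTrail rowwise f r v t → proj₂ (insFrom r v X) ≡ t
  insFrom-trail f r v [] rows ([] , e) (landsAt (suc zero) refl _ _ , _) = refl
  insFrom-trail f r v [] rows ([] , e) (landsAt (suc (suc c)) refl _ before , _)
    with before 1 (s≤s z≤n) (s≤s (s≤s z≤n))
  ... | _ , f1 , _ = contradiction (trans (sym f1) (trans (sym (RowsFrom-head rows 1)) (lab-[] (1 , 1)))) just≢nothing
  insFrom-trail f r v [] rows ((D , z) ∷ tr , e) ((landsAt c refl _ _ , fD , _) , _) =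
    contradiction (trans (sym fD) (trans (sym (RowsFrom-head rows c)) (lab-[] (c , 1)))) just≢nothing
  insFrom-trail f r v (L ∷ Ls) rows ([] , e) (landsAt (suc n) refl _ before , fe)
    with insRow v L | insRow-appends v L n (RowsFrom-prefixBelow rows before) (trans (RowsFrom-head rows (suc n)) fe)
  ... | L' , _ | refl , len = cong (λ k → [] , (suc k , r)) len
  insFrom-trail f r v (L ∷ Ls) rows ((D , z) ∷ tr , e) ((landsAt (suc n) refl _ before , fD , v<z) , valid)
    with insRow v L | insRow-bumps v L n z (RowsFrom-prefixBelow rows before) (trans (RowsFrom-head rows (suc n)) fD) v<z
  ... | L' , _ | refl with insFrom (suc r) z Ls | insFrom-trail f (suc r) z Ls (RowsFrom-tail rows) (tr , e) valid
  ...   | _ , _ | refl = refl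

  prefixBelow-smallerBefore : ∀ {L Ls f r v n} → RowsFrom (L ∷ Ls) f r →
                              PrefixBelow v L n → SmallerBefore rowwise f (suc n) r v
  prefixBelow-smallerBefore rows below (suc j) _ (s≤s j<n) with below j j<n
  ... | w , Lj , w<v = w , trans (sym (RowsFrom-head rows (suc j))) Lj , w<v

  insFrom-trail-valid : ∀ f r v X → RowsFrom X f r → LabelInjective f → (∀ c → f (c , r) ≢ just v) →
                        ValidTrail rowwise f r v (proj₂ (insFrom r v X))
  insFrom-trail-valid f r v [] rows inj v∉r =
    landsAt 1 refl (s≤s z≤n) (λ { (suc c) _ (s≤s ()) }) , sym (RowsFrom-head rows 1)
  insFrom-trail-valid f r v (L ∷ Ls) rows inj v∉r
    with insRow v L | insRow-position v L (λ j Lj → v∉r (suc j) (trans (sym (RowsFrom-head rows (suc j))) Lj))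
  ... | L' , nothing | below =
    landsAt (suc (length L)) refl (s≤s z≤n) (prefixBelow-smallerBefore rows below) ,
    trans (sym (RowsFrom-head rows (suc (length L)))) (lookupIdx-beyond L ℕ.≤-refl)
  ... | L' , just (c , z) | n , refl , Ln , v<z , below =
    (landsAt (suc n) refl (s≤s z≤n) (prefixBelow-smallerBefore rows below) ,
     trans (sym (RowsFrom-head rows (suc n))) Ln , v<z) ,
    insFrom-trail-valid f (suc r) z Ls (RowsFrom-tail rows) inj z∉next
    where
    z∉next : ∀ c → f (c , suc r) ≢ just z
    z∉next c fz = ℕ.1+n≢n (cong proj₂ (inj (c , suc r) (suc n , r) z fz (trans (sym (RowsFrom-head rows (suc n))) Ln)))

  -- Row insertion slides labels along its trail

  -- Row k + 1 of X is row r + k of the whole tableau.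
  record SlidesFrom (r : ℕ) (v : A) (X : Tab) (result : Tab × Trail) : Set ℓa where
    field
      off-trail : ∀ c k → (c , r + k) ∉ trailBoxes (proj₂ result) →
                  lab (proj₁ result) (c , suc k) ≡ lab X (c , suc k)
      on-trail  : ∀ c k w → ((c , r + k) , w) ∈ slide v (proj₂ result) → lab (proj₁ result) (c , suc k) ≡ just w
      rows≥     : ∀ D w → (D , w) ∈ slide v (proj₂ result) → r ℕ.≤ proj₂ D
  open SlidesFrom

  labelled-box-≡ : ∀ {c c' r r' : ℕ} {w w' : A} → ((c , r) , w) ≡ ((c' , r') , w') → c ≡ c' × r ≡ r' × w ≡ w'
  labelled-box-≡ refl = refl , refl , refl

  offset-zero : ∀ r k → r + k ≡ r → k ≡ 0
  offset-zero r k r+k≡r = ℕ.+-cancelˡ-≡ r k 0 (trans r+k≡r (sym (ℕ.+-identityʳ r)))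

  slides-new-row : ∀ r v → SlidesFrom r v [] ([ [ v ] ] , [] , (1 , r))
  slides-new-row r v = record { off-trail = off ; on-trail = on ; rows≥ = λ { _ _ (here refl) → ℕ.≤-refl } }
    where
    off : ∀ c k → (c , r + k) ∉ [ (1 , r) ] → lab [ [ v ] ] (c , suc k) ≡ lab [] (c , suc k)
    off zero          k       _   = refl
    off (suc zero)    zero    out = contradiction (here (cong (1 ,_) (ℕ.+-identityʳ r))) out
    off (suc (suc c)) zero    _   = refl
    off (suc c)       (suc k) _   = refl
    on : ∀ c k w → ((c , r + k) , w) ∈ [ ((1 , r) , v) ] → lab [ [ v ] ] (c , suc k) ≡ just w
    on c k w (here eq) with labelled-box-≡ eq
    ... | refl , r+k≡r , refl rewrite offset-zero r k r+k≡r = refl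

  slides-appended : ∀ r v L L' Ls → PlacedAt v L L' (length L) →
                    SlidesFrom r v (L ∷ Ls) (L' ∷ Ls , [] , (suc (length L) , r))
  slides-appended r v L L' Ls (new , same) =
    record { off-trail = off ; on-trail = on ; rows≥ = λ { _ _ (here refl) → ℕ.≤-refl } }
    where
    off : ∀ c k → (c , r + k) ∉ [ (suc (length L) , r) ] → lab (L' ∷ Ls) (c , suc k) ≡ lab (L ∷ Ls) (c , suc k)
    off zero    k       _   = refl
    off (suc j) zero    out = same j (λ j≡ → out (here (cong₂ _,_ (cong suc j≡) (ℕ.+-identityʳ r))))
    off (suc j) (suc k) _   = refl
    on : ∀ c k w → ((c , r + k) , w) ∈ [ ((suc (length L) , r) , v) ] → lab (L' ∷ Ls) (c , suc k) ≡ just w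
    on c k w (here eq) with labelled-box-≡ eq
    ... | refl , r+k≡r , refl rewrite offset-zero r k r+k≡r = new

  slides-bumped : ∀ r v L L' Ls Ls' n z tr e → PlacedAt v L L' n → SlidesFrom (suc r) z Ls (Ls' , tr , e) →
                  SlidesFrom r v (L ∷ Ls) (L' ∷ Ls' , ((suc n , r) , z) ∷ tr , e)
  slides-bumped r v L L' Ls Ls' n z tr e (new , same) rest = record { off-trail = off ; on-trail = on ; rows≥ = rows }
    where
    off : ∀ c k → (c , r + k) ∉ (suc n , r) ∷ trailBoxes (tr , e) →
          lab (L' ∷ Ls') (c , suc k) ≡ lab (L ∷ Ls) (c , suc k)
    off zero    k       _   = refl
    off (suc j) zero    out = same j (λ j≡ → out (here (cong₂ _,_ (cong suc j≡) (ℕ.+-identityʳ r))))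
    off (suc j) (suc k) out =
      off-trail rest (suc j) k λ m →
        out (there (subst (λ i → (suc j , i) ∈ trailBoxes (tr , e)) (sym (ℕ.+-suc r k)) m))
    on : ∀ c k w → ((c , r + k) , w) ∈ ((suc n , r) , v) ∷ slide z (tr , e) → lab (L' ∷ Ls') (c , suc k) ≡ just w
    on c k w (here eq) with labelled-box-≡ eq
    ... | refl , r+k≡r , refl rewrite offset-zero r k r+k≡r = new
    on c zero    w (there m) =
      contradiction (ℕ.≤-trans (rows≥ rest _ _ m) (ℕ.≤-reflexive (ℕ.+-identityʳ r))) ℕ.1+n≰n
    on c (suc k) w (there m) =
      trans (lab-∷ L' Ls' c k) (on-trail rest c k w (subst (λ i → ((c , i) , w) ∈ slide z (tr , e)) (ℕ.+-suc r k) m))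
    rows : ∀ D w → (D , w) ∈ ((suc n , r) , v) ∷ slide z (tr , e) → r ℕ.≤ proj₂ D
    rows D w (here refl) = ℕ.≤-refl
    rows D w (there m)   = ℕ.≤-trans (ℕ.n≤1+n r) (rows≥ rest D w m)

  insFrom-slides : ∀ r v X → SlidesFrom r v X (insFrom r v X)
  insFrom-slides r v [] = slides-new-row r v
  insFrom-slides r v (L ∷ Ls) with insRow v L | insRow-effect v L
  ... | L' , nothing      | placed                = slides-appended r v L L' Ls placed
  ... | L' , just (_ , z) | n , refl , _ , placed with insFrom (suc r) z Ls | insFrom-slides (suc r) z Ls
  ...   | Ls' , tr , e | rest = slides-bumped r v L L' Ls Ls' n z tr e placed rest

  rowInsert-off-trail : ∀ X v D → D ∉ trailBoxes (rowTrail X v) → lab (rowInsert X v) D ≡ lab X D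
  rowInsert-off-trail X v (zero  , k)     _   = refl
  rowInsert-off-trail X v (suc c , zero)  _   = refl
  rowInsert-off-trail X v (suc c , suc k) out = off-trail (insFrom-slides 1 v X) (suc c) k out

  rowInsert-on-trail : ∀ X v D w → (D , w) ∈ slide v (rowTrail X v) → lab (rowInsert X v) D ≡ just w
  rowInsert-on-trail X v (c , zero)  w m = contradiction (rows≥ (insFrom-slides 1 v X) _ w m) λ ()
  rowInsert-on-trail X v (c , suc k) w m = on-trail (insFrom-slides 1 v X) c k w m

  slideInit : A → List (Box × A) → List (Box × A)
  slideInit v []              = []
  slideInit v ((D , u) ∷ pre) = (D , v) ∷ slideInit u pre

  slideBeyond : List (Box × A) → Box → List (Box × A)
  slideBeyond []              e = []
  slideBeyond ((_ , u) ∷ post) e = slide u (post , e)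

  slide-head : ∀ z post e → slide z (post , e) ≡ (nextBox post e , z) ∷ slideBeyond post e
  slide-head z []          e = refl
  slide-head z (_ ∷ post) e = refl

  slide-split : ∀ v pre D z post e → slide v (pre ++ (D , z) ∷ post , e) ≡
                slideInit v pre ++ (D , prevLabel v pre) ∷ (nextBox post e , z) ∷ slideBeyond post e
  slide-split v []              D z post e = cong ((D , v) ∷_) (slide-head z post e)
  slide-split v ((C , u) ∷ pre) D z post e = cong ((C , v) ∷_) (slide-split u pre D z post e)

  trailBoxes-split : ∀ pre D (z : A) post e →
                     trailBoxes (pre ++ (D , z) ∷ post , e) ≡ map proj₁ pre ++ D ∷ trailBoxes (post , e)
  trailBoxes-split pre D z post e =
    trans (cong (_++ [ e ]) (map-++ proj₁ pre ((D , z) ∷ post))) (++-assoc (map proj₁ pre) _ [ e ])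

  nextBox-∈ : ∀ (post : List (Box × A)) e → nextBox post e ∈ trailBoxes (post , e)
  nextBox-∈ []       e = here refl
  nextBox-∈ (_ ∷ _) e = here refl

  slide-box-∈ : ∀ v t D w → (D , w) ∈ slide v t → D ∈ trailBoxes t
  slide-box-∈ v ([]            , e) D w (here refl) = here refl
  slide-box-∈ v ((_ , u) ∷ tr , e) D w (here refl) = here refl
  slide-box-∈ v ((_ , u) ∷ tr , e) D w (there m)   = there (slide-box-∈ u (tr , e) D w m)

  slide-label : ∀ v t D → D ∈ trailBoxes t → Σ A λ w → (D , w) ∈ slide v t
  slide-label v ([]            , e) D (here refl) = v , here refl
  slide-label v ((_ , u) ∷ tr , e) D (here refl) = v , here refl
  slide-label v ((_ , u) ∷ tr , e) D (there m)   = map₂ there (slide-label u (tr , e) D m)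

  prevLabel-∷ʳ : ∀ v pre (C : Box) u → prevLabel v (pre ∷ʳ (C , u)) ≡ u
  prevLabel-∷ʳ v []              C u = refl
  prevLabel-∷ʳ v ((_ , w) ∷ pre) C u = prevLabel-∷ʳ w pre C u

  slideInit-∷ʳ : ∀ v pre C u → (C , prevLabel v pre) ∈ slideInit v (pre ∷ʳ (C , u))
  slideInit-∷ʳ v []              C u = here refl
  slideInit-∷ʳ v ((_ , w) ∷ pre) C u = there (slideInit-∷ʳ w pre C u)

  ∈-replace : ∀ {b} {X : Set b} (xs : List X) {d d' : X} ys {D} → D ≢ d → D ∈ xs ++ d ∷ ys → D ∈ xs ++ d' ∷ ys
  ∈-replace []       ys D≢ (here refl) = contradiction refl D≢
  ∈-replace []       ys D≢ (there m)   = there m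
  ∈-replace (_ ∷ xs) ys D≢ (here refl) = here refl
  ∈-replace (_ ∷ xs) ys D≢ (there m)   = there (∈-replace xs ys D≢ m)

  ∈-replace₂ : ∀ {b} {X : Set b} (xs : List X) {d₁ d₂ d₁' d₂' : X} ys {D} → D ≢ d₁ → D ≢ d₂ →
               D ∈ xs ++ d₁ ∷ d₂ ∷ ys → D ∈ xs ++ d₁' ∷ d₂' ∷ ys
  ∈-replace₂ []       ys D≢₁ D≢₂ (here refl) = contradiction refl D≢₁
  ∈-replace₂ []       ys D≢₁ D≢₂ (there m)   = there (∈-replace [] ys D≢₂ m)
  ∈-replace₂ (_ ∷ xs) ys D≢₁ D≢₂ (here refl) = here refl
  ∈-replace₂ (_ ∷ xs) ys D≢₁ D≢₂ (there m)   = there (∈-replace₂ xs ys D≢₁ D≢₂ m)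

  valid-split : ∀ o f r v pre D z post e → ValidTrail o f r v (pre ++ (D , z) ∷ post , e) →
                Bumps o f (r + length pre) (prevLabel v pre) D z × ValidTrail o f (suc (r + length pre)) z (post , e)
  valid-split o f r v []              D z post e valid =
    subst (λ k → Bumps o f k v D z × ValidTrail o f (suc k) z (post , e)) (sym (ℕ.+-identityʳ r)) valid
  valid-split o f r v ((_ , u) ∷ pre) D z post e (_ , valid) =
    subst (λ k → Bumps o f k (prevLabel u pre) D z × ValidTrail o f (suc k) z (post , e))
          (sym (ℕ.+-suc r (length pre))) (valid-split o f (suc r) u pre D z post e valid)

  valid-landsAt : ∀ {o f r v} tr e → ValidTrail o f r v (tr , e) → LandsAt o f r v (nextBox tr e)
  valid-landsAt []       e (lands , _)       = lands
  valid-landsAt (_ ∷ _) e ((lands , _) , _) = lands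

  valid-lines≥ : ∀ {o f r v} t → ValidTrail o f r v t → ∀ D → D ∈ trailBoxes t →
                 Σ ℕ λ c → Σ ℕ λ k → D ≡ o c k × r ℕ.≤ k
  valid-lines≥ ([]           , e) (landsAt c refl _ _ , _)       D (here refl) = c , _ , refl , ℕ.≤-refl
  valid-lines≥ ((_ , z) ∷ tr , e) ((landsAt c refl _ _ , _) , _) D (here refl) = c , _ , refl , ℕ.≤-refl
  valid-lines≥ ((_ , z) ∷ tr , e) (_ , valid)                   D (there m)   =
    map₂ (map₂ (map₂ (ℕ.≤-trans (ℕ.n≤1+n _)))) (valid-lines≥ (tr , e) valid D m)

  valid-lines< : ∀ {o f r v} pre rest e → ValidTrail o f r v (pre ++ rest , e) → ∀ D → D ∈ map proj₁ pre →
                 Σ ℕ λ c → Σ ℕ λ k → D ≡ o c k × k ℕ.< r + length pre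
  valid-lines< {r = r} ((_ , z) ∷ pre) rest e ((landsAt c refl _ _ , _) , _) D (here refl) =
    c , r , refl , ℕ.m<m+n r (s≤s z≤n)
  valid-lines< {r = r} ((_ , z) ∷ pre) rest e (_ , valid) D (there m) =
    let c , k , D≡ , k< = valid-lines< pre rest e valid D m
    in c , k , D≡ , subst (k ℕ.<_) (sym (ℕ.+-suc r (length pre))) k<

  valid-slide-< : ∀ {o f r v} t → ValidTrail o f r v t → ∀ D w u → (D , w) ∈ slide v t → f D ≡ just u → w < u
  valid-slide-< ([]           , e) (_ , fe)             D w u (here refl) fD = contradiction (trans (sym fD) fe) just≢nothing
  valid-slide-< ((_ , z) ∷ tr , e) ((_ , fD' , v<z) , _) D w u (here refl) fD with trans (sym fD) fD'
  ... | refl = v<z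
  valid-slide-< ((_ , z) ∷ tr , e) (_ , valid)          D w u (there m)   fD = valid-slide-< (tr , e) valid D w u m fD

  record Predecessor (o : Orientation) (f : Labelling) (r : ℕ) (v : A) (pre : List (Box × A))
                     (rest : Trail) : Set (ℓa ⊔ ℓ) where
    constructor predecessor
    field
      init  : List (Box × A)
      box   : Box
      pre≡  : pre ≡ init ∷ʳ (box , prevLabel v pre)
      bumps : Bumps o f (r + length init) (prevLabel v init) box (prevLabel v pre)
      valid : ValidTrail o f (suc (r + length init)) (prevLabel v pre) rest

  valid-predecessor : ∀ o f r v pre D z post e → ValidTrail o f r v (pre ++ (D , z) ∷ post , e) →
                      pre ≡ [] ⊎ Predecessor o f r v pre ((D , z) ∷ post , e)
  valid-predecessor o f r v pre D z post e valid with initLast pre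
  ... | []                    = inj₁ refl
  ... | init ∷ʳ′ (C , u) =
    let bumpsC , validC = valid-split o f r v init C u ((D , z) ∷ post) e
                            (subst (λ l → ValidTrail o f r v (l , e)) (∷ʳ-++ init (C , u) ((D , z) ∷ post)) valid)
        last≡ = sym (prevLabel-∷ʳ v init C u)
    in inj₂ (predecessor init C (cong (λ w → init ∷ʳ (C , w)) last≡)
                         (subst (Bumps o f (r + length init) (prevLabel v init) C) last≡ bumpsC)
                         (subst (λ w → ValidTrail o f (suc (r + length init)) w ((D , z) ∷ post , e)) last≡ validC))

  module _ {o f r v pre rest} (π : Predecessor o f r v pre rest) where
    open Predecessor π

    predecessor-line : r + length pre ≡ suc (r + length init)
    predecessor-line = begin
      r + length pre                         ≡⟨ cong (λ l → r + length l) pre≡ ⟩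
      r + length (init ∷ʳ (box , _))         ≡⟨ cong (r +_) (length-++ init) ⟩
      r + (length init + 1)                  ≡⟨ cong (r +_) (ℕ.+-comm (length init) 1) ⟩
      r + suc (length init)                  ≡⟨ ℕ.+-suc r (length init) ⟩
      suc (r + length init)                  ∎
      where open ≡-Reasoning

    predecessor-∈ : box ∈ map proj₁ pre
    predecessor-∈ = subst (λ l → box ∈ map proj₁ l) (sym pre≡) (∈-map⁺ proj₁ (∈-++⁺ʳ init (here refl)))

    predecessor-slide : (box , prevLabel v init) ∈ slideInit v pre
    predecessor-slide = subst (λ l → (box , prevLabel v init) ∈ slideInit v l) (sym pre≡) (slideInit-∷ʳ v init box _)

  valid-next-label : ∀ {o f r v} tr e → ValidTrail o f r v (tr , e) →
                     (Σ A λ w → f (nextBox tr e) ≡ just w × v < w) ⊎ f (nextBox tr e) ≡ nothing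
  valid-next-label []      e (_ , fe)           = inj₂ fe
  valid-next-label (_ ∷ _) e ((_ , fD , v<z) , _) = inj₁ (_ , fD , v<z)

  IncreasingAcross : Orientation → Labelling → Set (ℓa ⊔ ℓ)
  IncreasingAcross o f = ∀ c r u u' → f (o c r) ≡ just u → f (o c (suc r)) ≡ just u' → u < u'

  valid-next-pos-≤ : ∀ {o f} → IncreasingAcross o f → ∀ c r z tr e → 1 ℕ.≤ c → f (o c r) ≡ just z →
                     ValidTrail o f (suc r) z (tr , e) →
                     Σ ℕ λ c' → nextBox tr e ≡ o c' (suc r) × 1 ℕ.≤ c' × c' ℕ.≤ c
  valid-next-pos-≤ increasing c r z tr e c≥1 fz valid with valid-landsAt tr e valid
  ... | landsAt c' next≡ c'≥1 before with c' ℕ.≤? c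
  ...   | yes c'≤c = c' , next≡ , c'≥1 , c'≤c
  ...   | no  c'≰c with before c c≥1 (ℕ.≰⇒> c'≰c)
  ...     | w , fw , w<z = contradiction (increasing c r z w fz fw) (asym w<z)

  swapTrail : Trail → Trail
  swapTrail (tr , e) = map (map₁ swapBox) tr , swapBox e

  trailBoxes-swap : ∀ t → trailBoxes (swapTrail t) ≡ map swapBox (trailBoxes t)
  trailBoxes-swap ([]           , e) = refl
  trailBoxes-swap ((D , _) ∷ tr , e) = cong (swapBox D ∷_) (trailBoxes-swap (tr , e))

  slide-swap : ∀ v t → slide v (swapTrail t) ≡ map (map₁ swapBox) (slide v t)
  slide-swap v ([]           , e) = refl
  slide-swap v ((D , z) ∷ tr , e) = cong ((swapBox D , v) ∷_) (slide-swap z (tr , e))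

  SmallerBefore-swap : ∀ {g f} → (∀ D → g D ≡ f (swapBox D)) → ∀ {c r v} →
                       SmallerBefore rowwise g c r v → SmallerBefore columnwise f c r v
  SmallerBefore-swap g≡ before c' c'≥1 c'<c = let w , gw , w<v = before c' c'≥1 c'<c in w , trans (sym (g≡ _)) gw , w<v

  valid-swap : ∀ g f r v t → (∀ D → g D ≡ f (swapBox D)) → ValidTrail rowwise g r v t →
               ValidTrail columnwise f r v (swapTrail t)
  valid-swap g f r v ([] , e) g≡ (landsAt c refl c≥1 before , ge) =
    landsAt c refl c≥1 (SmallerBefore-swap g≡ before) , trans (sym (g≡ e)) ge
  valid-swap g f r v ((D , z) ∷ tr , e) g≡ ((landsAt c refl c≥1 before , gD , v<z) , valid) =
    (landsAt c refl c≥1 (SmallerBefore-swap g≡ before) , trans (sym (g≡ D)) gD , v<z) ,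
    valid-swap g f (suc r) z (tr , e) g≡ valid

  LabelsLowered : Labelling → Labelling → Set (ℓa ⊔ ℓ)
  LabelsLowered g f = ∀ D u → f D ≡ just u → Σ A λ u' → g D ≡ just u' × u' ≼ u

  SmallerBefore-lowered : ∀ {o g f c r v} → LabelsLowered g f → SmallerBefore o f c r v → SmallerBefore o g c r v
  SmallerBefore-lowered lowered before c' c'≥1 c'<c with before c' c'≥1 c'<c
  ... | w , fw , w<v with lowered _ w fw
  ...   | w' , gw , w'≼w = w' , gw , ≼-<-trans w'≼w w<v

  LandsAt-lowered : ∀ {o g f r v D} → LabelsLowered g f → LandsAt o f r v D → LandsAt o g r v D
  LandsAt-lowered {o} lowered (landsAt c D≡ c≥1 before) = landsAt c D≡ c≥1 (SmallerBefore-lowered {o = o} lowered before)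

  valid-transfer : ∀ {o f g r v v'} tr e → ValidTrail o f r v (tr , e) → LabelsLowered g f →
                   (∀ D → D ∈ trailBoxes (tr , e) → g D ≡ f D) → v' ≼ v →
                   (∀ c → nextBox tr e ≡ o c r → SmallerBefore o f c r v → SmallerBefore o g c r v') →
                   ValidTrail o g r v' (tr , e)
  valid-transfer [] e (landsAt c e≡ c≥1 before , fe) lowered agree v'≼v first =
    landsAt c e≡ c≥1 (first c e≡ before) , trans (agree e (here refl)) fe
  valid-transfer {o} ((D , z) ∷ tr) e ((landsAt c D≡ c≥1 before , fD , v<z) , valid) lowered agree v'≼v first =
    (landsAt c D≡ c≥1 (first c D≡ before) , trans (agree D (here refl)) fD , ≼-<-trans v'≼v v<z) ,
    valid-transfer tr e valid lowered (λ D' m → agree D' (there m)) (inj₁ refl)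
                   (λ _ _ → SmallerBefore-lowered {o = o} lowered)

  valid-transfer-++ : ∀ {o f g r v} pre rest e rest' e' → ValidTrail o f r v (pre ++ rest , e) →
                      LabelsLowered g f → (∀ D → D ∈ map proj₁ pre → g D ≡ f D) →
                      ValidTrail o g (r + length pre) (prevLabel v pre) (rest' , e') →
                      ValidTrail o g r v (pre ++ rest' , e')
  valid-transfer-++ {o} {g = g} {r} {v} [] rest e rest' e' _ lowered agree valid' =
    subst (λ k → ValidTrail o g k v (rest' , e')) (ℕ.+-identityʳ r) valid'
  valid-transfer-++ {o} {g = g} {r} ((D , z) ∷ pre) rest e rest' e' ((lands , fD , v<z) , valid) lowered agree valid' =
    (LandsAt-lowered lowered lands , trans (agree D (here refl)) fD , v<z) ,
    valid-transfer-++ pre rest e rest' e' valid lowered (λ D' m → agree D' (there m))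
      (subst (λ k → ValidTrail o g k (prevLabel z pre) (rest' , e')) (ℕ.+-suc r (length pre)) valid')

  valid-first-in-line : ∀ {f r v} t → ValidTrail rowwise f r v t → ∀ D → D ∈ trailBoxes t → proj₂ D ≡ r →
                        D ≡ nextBox (proj₁ t) (proj₂ t)
  valid-first-in-line ([]          , e) _           D (here refl) _ = refl
  valid-first-in-line ((_ , _) ∷ tr , e) _           D (here refl) _ = refl
  valid-first-in-line ((_ , z) ∷ tr , e) (_ , valid) D (there m)   D-in-r with valid-lines≥ (tr , e) valid D m
  ... | _ , _ , refl , r<k = contradiction (subst (suc _ ℕ.≤_) D-in-r r<k) ℕ.1+n≰n

  valid-empty-supported : ∀ {f} → IncreasingAcross rowwise f → ∀ {r v} t → ValidTrail rowwise f r v t →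
                          ∀ c k → (c , suc k) ∈ trailBoxes t → f (c , suc k) ≡ nothing → r ℕ.≤ k →
                          Σ ℕ λ c' → Σ A λ w → f (c' , k) ≡ just w × c ℕ.≤ c'
  valid-empty-supported increasing ([] , e) (landsAt _ refl _ _ , _) c k (here refl) _ r≤k =
    contradiction r≤k ℕ.1+n≰n
  valid-empty-supported increasing ((_ , z) ∷ tr , e) ((_ , fD , _) , _) c k (here refl) empty _ =
    contradiction (trans (sym fD) empty) just≢nothing
  valid-empty-supported increasing {r} ((_ , z) ∷ tr , e) ((landsAt c₀ refl c₀≥1 _ , fD , _) , valid)
                        c k (there m) empty r≤k with r ℕ.≟ k
  ... | no r≢k = valid-empty-supported increasing (tr , e) valid c k m empty (ℕ.≤∧≢⇒< r≤k r≢k)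
  ... | yes refl with valid-next-pos-≤ increasing c₀ r z tr e c₀≥1 fD valid
  ...   | c' , next≡ , _ , c'≤c₀ =
    let c'≡c = cong proj₁ (sym (trans (valid-first-in-line (tr , e) valid (c , suc r) m refl) next≡))
    in c₀ , z , fD , subst (ℕ._≤ c₀) c'≡c c'≤c₀

  _≟Box_ : (D D' : Box) → Dec (D ≡ D')
  _≟Box_ = ≡-dec ℕ._≟_ ℕ._≟_

  open DecMembership _≟Box_ using (_∈?_)

  -- The new box ending the trail lies weakly left of the box bumped in the row below it.
  rowInsert-downClosed : ∀ X v → DownClosed X → IncreasingAcross rowwise (lab X) →
                         ValidTrail rowwise (lab X) 1 v (rowTrail X v) → DownClosed (rowInsert X v)
  rowInsert-downClosed X v closed increasing valid c r u Yu with (suc c , suc r) ∈? trailBoxes (rowTrail X v)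
  ... | yes m = let w , m' = slide-label v (rowTrail X v) _ m in w , rowInsert-on-trail X v _ w m'
  ... | no out with (suc c , suc (suc r)) ∈? trailBoxes (rowTrail X v)
  ...   | no out' = let w , lw = closed c r u (trans (sym (rowInsert-off-trail X v _ out')) Yu)
                    in w , trans (rowInsert-off-trail X v _ out) lw
  ...   | yes m' with lab X (suc c , suc (suc r)) in e
  ...     | just u' = let w , lw = closed c r u' e in w , trans (rowInsert-off-trail X v _ out) lw
  ...     | nothing with valid-empty-supported increasing (rowTrail X v) valid (suc c) (suc r) m' e (s≤s z≤n)
  ...       | c' , w , lw , c≤c' = let w' , lw' = lab-leftClosed X (s≤s z≤n) c≤c' (w , lw)
                                   in w' , trans (rowInsert-off-trail X v _ out) lw'

  module TableauFacts (T : Tab) (isT : IsTableau T) where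
    open IsTableau isT

    downClosed : DownClosed T
    downClosed c r u = lowerIdeal (suc c) (suc (suc r)) (suc c) (suc r) u (s≤s z≤n) (s≤s z≤n) ℕ.≤-refl (ℕ.n≤1+n _)

    column-≼ : ∀ {c r r' u u'} → r ℕ.≤ r' → lab T (c , r) ≡ just u → lab T (c , r') ≡ just u' → u ≼ u'
    column-≼ r≤r' lu lu' with ℕ.m≤n⇒m<n∨m≡n r≤r'
    ... | inj₂ refl = inj₁ (just-injective (trans (sym lu) lu'))
    column-≼ {c} {r} {suc r''} {u' = u'} _ lu lu' | inj₁ (s≤s r≤r'') =
      let c≥1 , r≥1 = lab-≥1 T c r lu
          w , lw = lowerIdeal c (suc r'') c r'' u' c≥1 (ℕ.≤-trans r≥1 r≤r'') ℕ.≤-refl (ℕ.n≤1+n r'') lu'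
      in inj₂ (≼-<-trans (column-≼ {c} r≤r'' lu lw) (colIncr c r'' w u' lw lu'))

    row-≼ : ∀ {c c' r u u'} → c ℕ.≤ c' → lab T (c , r) ≡ just u → lab T (c' , r) ≡ just u' → u ≼ u'
    row-≼ c≤c' lu lu' with ℕ.m≤n⇒m<n∨m≡n c≤c'
    ... | inj₂ refl = inj₁ (just-injective (trans (sym lu) lu'))
    row-≼ {c} {suc c''} {r} {u' = u'} _ lu lu' | inj₁ (s≤s c≤c'') =
      let c≥1 , r≥1 = lab-≥1 T c r lu
          w , lw = lowerIdeal (suc c'') r c'' r u' (ℕ.≤-trans c≥1 c≤c'') r≥1 (ℕ.n≤1+n c'') ℕ.≤-refl lu'
      in inj₂ (≼-<-trans (row-≼ {r = r} c≤c'' lu lw) (rowIncr c'' r w u' lw lu'))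

    lab-monotone : ∀ {c c' r r' u u'} → c ℕ.≤ c' → r ℕ.≤ r' → lab T (c , r) ≡ just u → lab T (c' , r') ≡ just u' →
                   (c , r) ≡ (c' , r') ⊎ u < u'
    lab-monotone {c} {c'} {r} {r'} {u' = u'} c≤c' r≤r' lu lu'
      with lowerIdeal c' r' c r' u' (proj₁ (lab-≥1 T c r lu)) (proj₂ (lab-≥1 T c' r' lu')) c≤c' ℕ.≤-refl lu'
    ... | w , lw with column-≼ {c} r≤r' lu lw | row-≼ {r = r'} c≤c' lw lu'
    ...   | inj₁ refl | inj₁ refl = inj₁ (injective (c , r) (c' , r') _ lu lu')
    ...   | inj₁ refl | inj₂ w<u' = inj₂ w<u'
    ...   | inj₂ u<w  | w≼u'      = inj₂ (<-≼-trans u<w w≼u')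

    increasing-rowwise : IncreasingAcross rowwise (lab T)
    increasing-rowwise c r = colIncr c r

    increasing-columnwise : IncreasingAcross columnwise (lab T)
    increasing-columnwise c r = rowIncr r c

    rowTrail-valid : ∀ v → NotLabel v T → ValidTrail rowwise (lab T) 1 v (rowTrail T v)
    rowTrail-valid v v∉T = insFrom-trail-valid (lab T) 1 v T (rowsFrom λ _ _ → refl) injective (λ c → v∉T (c , 1))

    lab-transposed : ∀ D → lab (transpose T) D ≡ lab T (swapBox D)
    lab-transposed = lab-transpose T downClosed

    transposed-downClosed : DownClosed (transpose T)
    transposed-downClosed c r u lu =
      let w , lw = lowerIdeal (suc (suc r)) (suc c) (suc r) (suc c) u (s≤s z≤n) (s≤s z≤n) (ℕ.n≤1+n _) ℕ.≤-refl
                              (trans (sym (lab-transposed _)) lu)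
      in w , trans (lab-transposed _) lw

    transposed-injective : LabelInjective (lab (transpose T))
    transposed-injective D D' u lu lu' =
      cong swapBox (injective (swapBox D) (swapBox D') u (trans (sym (lab-transposed D)) lu)
                                                          (trans (sym (lab-transposed D')) lu'))

    transposed-increasing : IncreasingAcross rowwise (lab (transpose T))
    transposed-increasing c r u u' lu lu' =
      rowIncr r c u u' (trans (sym (lab-transposed (c , r))) lu) (trans (sym (lab-transposed (c , suc r))) lu')

    module ColumnInsertion (x : A) (x∉T : NotLabel x T) where
      private
        T' : Tab
        T' = transpose T

      transposed-trail-valid : ValidTrail rowwise (lab T') 1 x (rowTrail T' x)
      transposed-trail-valid = insFrom-trail-valid (lab T') 1 x T' (rowsFrom λ _ _ → refl) transposed-injective
                                 (λ c lx → x∉T (1 , c) (trans (sym (lab-transposed (c , 1))) lx))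

      colTrail-valid : ValidTrail columnwise (lab T) 1 x (colTrail x T)
      colTrail-valid = valid-swap (lab T') (lab T) 1 x (rowTrail T' x) lab-transposed transposed-trail-valid

      lab-colInsert : ∀ D → lab (colInsert x T) D ≡ lab (rowInsert T' x) (swapBox D)
      lab-colInsert = lab-transpose (rowInsert T' x)
                        (rowInsert-downClosed T' x transposed-downClosed transposed-increasing transposed-trail-valid)

      colInsert-on-trail : ∀ D w → (D , w) ∈ slide x (colTrail x T) → lab (colInsert x T) D ≡ just w
      colInsert-on-trail D w m with ∈-map⁻ (map₁ swapBox) (subst ((D , w) ∈_) (slide-swap x (rowTrail T' x)) m)
      ... | (D' , w) , m' , refl = trans (lab-colInsert (swapBox D')) (rowInsert-on-trail T' x D' w m')

      colInsert-off-trail : ∀ D → D ∉ trailBoxes (colTrail x T) → lab (colInsert x T) D ≡ lab T D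
      colInsert-off-trail D out =
        trans (lab-colInsert D) (trans (rowInsert-off-trail T' x (swapBox D) out') (lab-transposed (swapBox D)))
        where
        out' : swapBox D ∉ trailBoxes (rowTrail T' x)
        out' m = out (subst (D ∈_) (sym (trailBoxes-swap (rowTrail T' x))) (∈-map⁺ swapBox m))

      colInsert-lowers : LabelsLowered (lab (colInsert x T)) (lab T)
      colInsert-lowers D u lu with D ∈? trailBoxes (colTrail x T)
      ... | yes m = let w , m' = slide-label x (colTrail x T) D m
                    in w , colInsert-on-trail D w m' , inj₂ (valid-slide-< (colTrail x T) colTrail-valid D w u m' lu)
      ... | no out = u , trans (colInsert-off-trail D out) lu , inj₁ refl

  -- Two trails crossing in S

  module Crossing (T : Tab) (isT : IsTableau T) (x y : A) (x≢y : x ≢ y) (x∉T : NotLabel x T) (y∉T : NotLabel y T)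
                  (S : Box) (s : A) (preC postC preR postR : List (Box × A))
                  (colTrail≡ : proj₁ (colTrail x T) ≡ preC ++ (S , s) ∷ postC)
                  (rowTrail≡ : proj₁ (rowTrail T y) ≡ preR ++ (S , s) ∷ postR)
                  (meet-at-S : ∀ D → D ∈ trailBoxes (colTrail x T) → D ∈ trailBoxes (rowTrail T y) → D ≡ S) where
    open IsTableau isT
    open TableauFacts T isT
    open ColumnInsertion x x∉T

    f g : Labelling
    f = lab T
    g = lab (colInsert x T)

    eC eR B J : Box
    eC = proj₂ (colTrail x T)
    eR = proj₂ (rowTrail T y)
    B  = nextBox postC eC
    J  = nextBox postR eR

    a i : A
    a = prevLabel x preC
    i = prevLabel y preR

    U : Tab
    U = rowInsert (colInsert x T) y

    colS rowS : ℕ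
    colS = 1 + length preC
    rowS = 1 + length preR

    column-valid : ValidTrail columnwise f 1 x (preC ++ (S , s) ∷ postC , eC)
    column-valid = subst (λ l → ValidTrail columnwise f 1 x (l , eC)) colTrail≡ colTrail-valid

    row-valid : ValidTrail rowwise f 1 y (preR ++ (S , s) ∷ postR , eR)
    row-valid = subst (λ l → ValidTrail rowwise f 1 y (l , eR)) rowTrail≡ (rowTrail-valid y y∉T)

    S-in-row : Bumps rowwise f rowS i S s
    S-in-row = proj₁ (valid-split rowwise f 1 y preR S s postR eR row-valid)

    after-S-in-row : ValidTrail rowwise f (suc rowS) s (postR , eR)
    after-S-in-row = proj₂ (valid-split rowwise f 1 y preR S s postR eR row-valid)

    S-in-column : Bumps columnwise f colS a S s
    S-in-column = proj₁ (valid-split columnwise f 1 x preC S s postC eC column-valid)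

    after-S-in-column : ValidTrail columnwise f (suc colS) s (postC , eC)
    after-S-in-column = proj₂ (valid-split columnwise f 1 x preC S s postC eC column-valid)

    pos-in-row≡ : LandsAt.pos (proj₁ S-in-row) ≡ colS
    pos-in-row≡ = cong proj₁ (trans (sym (LandsAt.box≡ (proj₁ S-in-row))) (LandsAt.box≡ (proj₁ S-in-column)))

    pos-in-column≡ : LandsAt.pos (proj₁ S-in-column) ≡ rowS
    pos-in-column≡ = cong proj₂ (trans (sym (LandsAt.box≡ (proj₁ S-in-column))) (LandsAt.box≡ (proj₁ S-in-row)))

    S≡ : S ≡ (colS , rowS)
    S≡ = trans (LandsAt.box≡ (proj₁ S-in-row)) (cong (_, rowS) pos-in-row≡)

    before-S-in-row : SmallerBefore rowwise f colS rowS i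
    before-S-in-row = subst (λ c → SmallerBefore rowwise f c rowS i) pos-in-row≡ (LandsAt.before (proj₁ S-in-row))

    before-S-in-column : SmallerBefore columnwise f rowS colS a
    before-S-in-column =
      subst (λ c → SmallerBefore columnwise f c colS a) pos-in-column≡ (LandsAt.before (proj₁ S-in-column))

    fS : f (colS , rowS) ≡ just s
    fS = subst (λ D → f D ≡ just s) S≡ (proj₁ (proj₂ S-in-row))

    i<s : i < s
    i<s = proj₂ (proj₂ S-in-row)

    a<s : a < s
    a<s = proj₂ (proj₂ S-in-column)

    J-position : Σ ℕ λ c → J ≡ (c , suc rowS) × 1 ℕ.≤ c × c ℕ.≤ colS
    J-position = valid-next-pos-≤ increasing-rowwise colS rowS s postR eR (s≤s z≤n) fS after-S-in-row

    B-position : Σ ℕ λ r → B ≡ (suc colS , r) × 1 ℕ.≤ r × r ℕ.≤ rowS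
    B-position = valid-next-pos-≤ increasing-columnwise rowS colS s postC eC (s≤s z≤n) fS after-S-in-column

    B≢S : B ≢ S
    B≢S B≡S = ℕ.1+n≢n (cong proj₁ (trans (sym (proj₁ (proj₂ B-position))) (trans B≡S S≡)))

    column-boxes≡ : trailBoxes (colTrail x T) ≡ map proj₁ preC ++ S ∷ trailBoxes (postC , eC)
    column-boxes≡ = trans (cong (λ l → trailBoxes (l , eC)) colTrail≡) (trailBoxes-split preC S s postC eC)

    row-boxes≡ : trailBoxes (rowTrail T y) ≡ map proj₁ preR ++ S ∷ trailBoxes (postR , eR)
    row-boxes≡ = trans (cong (λ l → trailBoxes (l , eR)) rowTrail≡) (trailBoxes-split preR S s postR eR)

    column-slide≡ : slide x (colTrail x T) ≡ slideInit x preC ++ (S , a) ∷ (B , s) ∷ slideBeyond postC eC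
    column-slide≡ = trans (cong (λ l → slide x (l , eC)) colTrail≡) (slide-split x preC S s postC eC)

    row-slide≡ : slide y (rowTrail T y) ≡ slideInit y preR ++ (S , i) ∷ (J , s) ∷ slideBeyond postR eR
    row-slide≡ = trans (cong (λ l → slide y (l , eR)) rowTrail≡) (slide-split y preR S s postR eR)

    in-column-pre : ∀ {D} → D ∈ map proj₁ preC → D ∈ trailBoxes (colTrail x T)
    in-column-pre m = subst (_ ∈_) (sym column-boxes≡) (∈-++⁺ˡ m)

    in-row-pre : ∀ {D} → D ∈ map proj₁ preR → D ∈ trailBoxes (rowTrail T y)
    in-row-pre m = subst (_ ∈_) (sym row-boxes≡) (∈-++⁺ˡ m)

    B∉row : B ∉ trailBoxes (rowTrail T y)
    B∉row = B≢S ∘ meet-at-S B (subst (B ∈_) (sym column-boxes≡) (∈-++⁺ʳ (map proj₁ preC) (there (nextBox-∈ postC eC))))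

    gS : g S ≡ just a
    gS = colInsert-on-trail S a (subst ((S , a) ∈_) (sym column-slide≡) (∈-++⁺ʳ (slideInit x preC) (here refl)))

    gB : g B ≡ just s
    gB = colInsert-on-trail B s (subst ((B , s) ∈_) (sym column-slide≡) (∈-++⁺ʳ (slideInit x preC) (there (here refl))))

    pre-row-≢S : ∀ D → D ∈ map proj₁ preR → D ≢ S
    pre-row-≢S D m D≡S with valid-lines< preR ((S , s) ∷ postR) eR row-valid D m
    ... | _ , _ , refl , k<rowS = ℕ.<-irrefl (cong proj₂ (trans D≡S S≡)) k<rowS

    post-row-≢S : ∀ D → D ∈ trailBoxes (postR , eR) → D ≢ S
    post-row-≢S D m D≡S with valid-lines≥ (postR , eR) after-S-in-row D m
    ... | _ , _ , refl , rowS<k = ℕ.<-irrefl (sym (cong proj₂ (trans D≡S S≡))) rowS<k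

    g≡f-pre : ∀ D → D ∈ map proj₁ preR → g D ≡ f D
    g≡f-pre D m = colInsert-off-trail D (λ mC → pre-row-≢S D m (meet-at-S D mC (in-row-pre m)))

    g≡f-post : ∀ D → D ∈ trailBoxes (postR , eR) → g D ≡ f D
    g≡f-post D m = colInsert-off-trail D λ mC →
      post-row-≢S D m (meet-at-S D mC (subst (D ∈_) (sym row-boxes≡) (∈-++⁺ʳ (map proj₁ preR) (there m))))

    i≢a : i ≢ a
    i≢a i≡a with valid-predecessor rowwise f 1 y preR S s postR eR row-valid
               | valid-predecessor columnwise f 1 x preC S s postC eC column-valid
    ... | inj₁ preR≡[] | inj₁ preC≡[] =
      x≢y (trans (cong (prevLabel x) (sym preC≡[])) (trans (sym i≡a) (cong (prevLabel y) preR≡[])))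
    ... | inj₁ preR≡[] | inj₂ πC =
      y∉T (Predecessor.box πC) (trans (proj₁ (proj₂ (Predecessor.bumps πC)))
                                      (cong just (trans (sym i≡a) (cong (prevLabel y) preR≡[]))))
    ... | inj₂ πR | inj₁ preC≡[] =
      x∉T (Predecessor.box πR) (trans (proj₁ (proj₂ (Predecessor.bumps πR)))
                                      (cong just (trans i≡a (cong (prevLabel x) preC≡[]))))
    ... | inj₂ πR | inj₂ πC =
      pre-row-≢S R (predecessor-∈ πR)
        (meet-at-S R (subst (_∈ _) (sym R≡C) (in-column-pre (predecessor-∈ πC))) (in-row-pre (predecessor-∈ πR)))
      where
      R = Predecessor.box πR
      R≡C : R ≡ Predecessor.box πC
      R≡C = injective R (Predecessor.box πC) a (trans (proj₁ (proj₂ (Predecessor.bumps πR))) (cong just i≡a))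
                                              (proj₁ (proj₂ (Predecessor.bumps πC)))

    -- The label a of C cannot sit left of S in the row of S, where labels are below i.
    column-predecessor-above : i < a → (π : Predecessor columnwise f 1 x preC ((S , s) ∷ postC , eC)) →
                               rowS ℕ.< LandsAt.pos (proj₁ (Predecessor.bumps π))
    column-predecessor-above i<a π@(predecessor init C _ (landsAt γ refl γ≥1 _ , fC , _) valid) =
      ℕ.≤∧≢⇒< rowS≤γ (γ≢rowS ∘ sym)
      where
      rowS≤γ : rowS ℕ.≤ γ
      rowS≤γ with valid-next-pos-≤ increasing-columnwise γ (1 + length init) a ((S , s) ∷ postC) eC γ≥1 fC valid
      ... | r , S≡' , _ , r≤γ = subst (ℕ._≤ γ) (cong proj₂ (trans (sym S≡') S≡)) r≤γ
      γ≢rowS : γ ≢ rowS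
      γ≢rowS refl with before-S-in-row (1 + length init) (s≤s z≤n) (ℕ.≤-reflexive (sym (predecessor-line π)))
      ... | w , fw , w<i = asym i<a (subst (_< i) (just-injective (trans (sym fw) fC)) w<i)

    -- Symmetrically, the label i of R cannot sit below S in the column of S.
    row-predecessor-right : a < i → (π : Predecessor rowwise f 1 y preR ((S , s) ∷ postR , eR)) →
                            colS ℕ.< LandsAt.pos (proj₁ (Predecessor.bumps π))
    row-predecessor-right a<i π@(predecessor init R _ (landsAt c refl c≥1 _ , fR , _) valid) =
      ℕ.≤∧≢⇒< colS≤c (c≢colS ∘ sym)
      where
      colS≤c : colS ℕ.≤ c
      colS≤c with valid-next-pos-≤ increasing-rowwise c (1 + length init) i ((S , s) ∷ postR) eR c≥1 fR valid
      ... | c' , S≡' , _ , c'≤c = subst (ℕ._≤ c) (cong proj₁ (trans (sym S≡') S≡)) c'≤c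
      c≢colS : c ≢ colS
      c≢colS refl with before-S-in-column (1 + length init) (s≤s z≤n) (ℕ.≤-reflexive (sym (predecessor-line π)))
      ... | w , fw , w<a = asym a<i (subst (_< a) (just-injective (trans (sym fw) fR)) w<a)

    J-column≤colS : ∀ {c} → J ≡ (c , suc rowS) → c ℕ.≤ colS
    J-column≤colS J≡ =
      let _ , J≡' , _ , cJ≤colS = J-position in subst (ℕ._≤ colS) (cong proj₁ (trans (sym J≡') J≡)) cJ≤colS

    -- Boxes left of J lie weakly south-west of the column predecessor C of S: C now holds a label
    -- below a, and the other boxes hold labels below that of C, which is a.
    before-J-lowered : i < a → ∀ c → J ≡ (c , suc rowS) → SmallerBefore rowwise f c (suc rowS) s →
                       SmallerBefore rowwise g c (suc rowS) a
    before-J-lowered i<a c J≡ before c' c'≥1 c'<c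
      with valid-predecessor columnwise f 1 x preC S s postC eC column-valid
    ... | inj₁ preC≡[] =
      contradiction c'≥1
        (ℕ.<⇒≱ (ℕ.<-≤-trans c'<c (subst (c ℕ.≤_) (cong (λ l → 1 + length l) preC≡[]) (J-column≤colS J≡))))
    ... | inj₂ π@(predecessor init _ _ (landsAt γ refl _ _ , fC , prev<a) _)
      with before c' c'≥1 c'<c
    ...   | w , fw , _
      with lab-monotone (ℕ.≤-pred (subst (suc c' ℕ.≤_) (predecessor-line π) (ℕ.<-≤-trans c'<c (J-column≤colS J≡))))
                        (column-predecessor-above i<a π) fw fC
    ...     | inj₁ refl =
      prevLabel x init ,
      colInsert-on-trail _ _ (subst (_ ∈_) (sym column-slide≡) (∈-++⁺ˡ (predecessor-slide π))) ,
      prev<a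
    ...     | inj₂ w<a = let w' , gw , w'≼w = colInsert-lowers (c' , suc rowS) w fw in w' , gw , ≼-<-trans w'≼w w<a

    -- Weakly south-west of R the label of B would be below i < s, but it exceeds s.
    B-above-row-predecessor : a < i → (π : Predecessor rowwise f 1 y preR ((S , s) ∷ postR , eR)) →
                              ∀ r → B ≡ (suc colS , r) → 1 ℕ.≤ r → ¬ r ℕ.≤ 1 + length (Predecessor.init π)
    B-above-row-predecessor a<i π@(predecessor init _ _ (landsAt c refl _ _ , fR , _) _) r B≡ r≥1 r≤k
      with valid-next-label postC eC after-S-in-column
    ... | inj₁ (wB , fB , s<wB) with lab-monotone (row-predecessor-right a<i π) r≤k (subst (λ D → f D ≡ just wB) B≡ fB) fR
    ...   | inj₁ B≡R  = B∉row (subst (_∈ _) (sym (trans B≡ B≡R)) (in-row-pre (predecessor-∈ π)))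
    ...   | inj₂ wB<i = asym wB<i (<-trans i<s s<wB)
    B-above-row-predecessor a<i π@(predecessor init _ _ (landsAt c refl _ _ , fR , _) _) r B≡ r≥1 r≤k | inj₂ B-empty =
      let w , fw = lowerIdeal c (1 + length init) (suc colS) r i (s≤s z≤n) r≥1 (row-predecessor-right a<i π) r≤k fR
      in just≢nothing (trans (sym fw) (subst (λ D → f D ≡ nothing) B≡ B-empty))

    rowS≤B-row : a < i → ∀ r → B ≡ (suc colS , r) → 1 ℕ.≤ r → rowS ℕ.≤ r
    rowS≤B-row a<i r B≡ r≥1 with valid-predecessor rowwise f 1 y preR S s postR eR row-valid
    ... | inj₁ preR≡[] = subst (ℕ._≤ r) (sym (cong (λ l → 1 + length l) preR≡[])) r≥1
    ... | inj₂ π with rowS ℕ.≤? r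
    ...   | yes rowS≤r = rowS≤r
    ...   | no  rowS≰r = contradiction (ℕ.≤-pred (subst (suc r ℕ.≤_) (predecessor-line π) (ℕ.≰⇒> rowS≰r)))
                                       (B-above-row-predecessor a<i π r B≡ r≥1)

    B-in-row-of-S : a < i → B ≡ (suc colS , rowS)
    B-in-row-of-S a<i =
      let r , B≡ , r≥1 , r≤rowS = B-position
      in trans B≡ (cong (suc colS ,_) (ℕ.≤-antisym r≤rowS (rowS≤B-row a<i r B≡ r≥1)))

    -- The row trail of y in x → T is the old one with (S , s) replaced by (S , a) or by (B , s).
    newTrail : Box → A → Trail
    newTrail K z = preR ++ (K , z) ∷ postR , eR

    newTrail-valid : ∀ K z → Bumps rowwise g rowS i K z → ValidTrail rowwise g (suc rowS) z (postR , eR) →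
                     ValidTrail rowwise g 1 y (newTrail K z)
    newTrail-valid K z bumps rest =
      valid-transfer-++ preR ((S , s) ∷ postR) eR ((K , z) ∷ postR) eR row-valid colInsert-lowers g≡f-pre (bumps , rest)

    newTrail-valid-i<a : i < a → ValidTrail rowwise g 1 y (newTrail S a)
    newTrail-valid-i<a i<a = newTrail-valid S a
      (landsAt colS S≡ (s≤s z≤n) (SmallerBefore-lowered {o = rowwise} colInsert-lowers before-S-in-row) , gS , i<a)
      (valid-transfer postR eR after-S-in-row colInsert-lowers g≡f-post (inj₂ a<s) (before-J-lowered i<a))

    newTrail-valid-a<i : a < i → ValidTrail rowwise g 1 y (newTrail B s)
    newTrail-valid-a<i a<i = newTrail-valid B s
      (landsAt (suc colS) (B-in-row-of-S a<i) (s≤s z≤n) before-B , gB , i<s)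
      (valid-transfer postR eR after-S-in-row colInsert-lowers g≡f-post (inj₁ refl)
                      (λ _ _ → SmallerBefore-lowered {o = rowwise} colInsert-lowers))
      where
      before-B : SmallerBefore rowwise g (suc colS) rowS i
      before-B c c≥1 c<1+colS with c ℕ.≟ colS
      ... | yes refl = a , subst (λ D → g D ≡ just a) S≡ gS , a<i
      ... | no  c≢colS = SmallerBefore-lowered {o = rowwise} colInsert-lowers before-S-in-row c c≥1
                                             (ℕ.≤∧≢⇒< (ℕ.≤-pred c<1+colS) c≢colS)

    SlidOrKept : Box → Set ℓa
    SlidOrKept D = (D ∉ trailBoxes (colTrail x T) → D ∉ trailBoxes (rowTrail T y) → lab U D ≡ lab T D) ×
                   (∀ v → (D , v) ∈ slide x (colTrail x T) → lab U D ≡ just v) ×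
                   (∀ v → (D , v) ∈ slide y (rowTrail T y) → lab U D ≡ just v)

    module RowInsertionAlong (K : Box) (z : A) (K≡S⊎K≡B : K ≡ S ⊎ K ≡ B)
                             (valid : ValidTrail rowwise g 1 y (newTrail K z)) where
      rowTrail≡newTrail : rowTrail (colInsert x T) y ≡ newTrail K z
      rowTrail≡newTrail = insFrom-trail g 1 y (colInsert x T) (rowsFrom λ _ _ → refl) (newTrail K z) valid

      new-boxes≡ : trailBoxes (newTrail K z) ≡ map proj₁ preR ++ K ∷ trailBoxes (postR , eR)
      new-boxes≡ = trailBoxes-split preR K z postR eR

      new-slide≡ : slide y (newTrail K z) ≡ slideInit y preR ++ (K , i) ∷ (J , z) ∷ slideBeyond postR eR
      new-slide≡ = slide-split y preR K z postR eR

      U-off-trail : ∀ D → D ∉ trailBoxes (newTrail K z) → lab U D ≡ g D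
      U-off-trail D out =
        rowInsert-off-trail (colInsert x T) y D (subst (λ t → D ∉ trailBoxes t) (sym rowTrail≡newTrail) out)

      U-on-trail : ∀ D w → (D , w) ∈ slide y (newTrail K z) → lab U D ≡ just w
      U-on-trail D w m =
        rowInsert-on-trail (colInsert x T) y D w (subst (λ t → (D , w) ∈ slide y t) (sym rowTrail≡newTrail) m)

      U-K : lab U K ≡ just i
      U-K = U-on-trail K i (subst ((K , i) ∈_) (sym new-slide≡) (∈-++⁺ʳ (slideInit y preR) (here refl)))

      U-J : lab U J ≡ just z
      U-J = U-on-trail J z (subst ((J , z) ∈_) (sym new-slide≡) (∈-++⁺ʳ (slideInit y preR) (there (here refl))))

      off-new-trail : ∀ D → D ∉ trailBoxes (rowTrail T y) → D ≢ K → D ∉ trailBoxes (newTrail K z)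
      off-new-trail D out D≢K m =
        out (subst (D ∈_) (sym row-boxes≡)
                   (∈-replace (map proj₁ preR) (trailBoxes (postR , eR)) D≢K (subst (D ∈_) new-boxes≡ m)))

      other-boxes : ∀ D → D ≢ S → D ≢ B → D ≢ J → SlidOrKept D
      other-boxes D D≢S D≢B D≢J =
        (λ outC outR → trans (U-off-trail D (off-new-trail D outR D≢K)) (colInsert-off-trail D outC)) ,
        (λ v m → let outR = D≢S ∘ meet-at-S D (slide-box-∈ x (colTrail x T) D v m)
                 in trans (U-off-trail D (off-new-trail D outR D≢K)) (colInsert-on-trail D v m)) ,
        (λ v m → U-on-trail D v (subst ((D , v) ∈_) (sym new-slide≡)
                   (∈-replace₂ (slideInit y preR) (slideBeyond postR eR) (D≢S ∘ cong proj₁) (D≢J ∘ cong proj₁)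
                               (subst ((D , v) ∈_) row-slide≡ m))))
        where
        D≢K : D ≢ K
        D≢K = [ (λ K≡S → subst (D ≢_) (sym K≡S) D≢S) , (λ K≡B → subst (D ≢_) (sym K≡B) D≢B) ]′ K≡S⊎K≡B

    labels-when-i<a : i < a → lab U S ≡ just i × lab U B ≡ just s × lab U J ≡ just a
    labels-when-i<a i<a = U-K , trans (U-off-trail B (off-new-trail B B∉row B≢S)) gB , U-J
      where open RowInsertionAlong S a (inj₁ refl) (newTrail-valid-i<a i<a)

    labels-when-a<i : a < i → lab U S ≡ just a × lab U B ≡ just i × lab U J ≡ just s
    labels-when-a<i a<i = trans (U-off-trail S S∉newTrail) gS , U-K , U-J
      where
      open RowInsertionAlong B s (inj₂ refl) (newTrail-valid-a<i a<i)
      S∉newTrail : S ∉ trailBoxes (newTrail B s)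
      S∉newTrail m with ∈-++⁻ (map proj₁ preR) (subst (S ∈_) new-boxes≡ m)
      ... | inj₁ m-pre          = pre-row-≢S S m-pre refl
      ... | inj₂ (here S≡B)     = B≢S (sym S≡B)
      ... | inj₂ (there m-post) = post-row-≢S S m-post refl

    other-boxes : ∀ D → D ≢ S → D ≢ B → D ≢ J → SlidOrKept D
    other-boxes D D≢S D≢B D≢J with compare i a
    ... | tri< i<a _ _ = RowInsertionAlong.other-boxes S a (inj₁ refl) (newTrail-valid-i<a i<a) D D≢S D≢B D≢J
    ... | tri≈ _ i≡a _ = contradiction i≡a i≢a
    ... | tri> _ _ a<i = RowInsertionAlong.other-boxes B s (inj₂ refl) (newTrail-valid-a<i a<i) D D≢S D≢B D≢J

proposition9 : ∀ {a ℓ : Level} {A : Set a} {_<_ : Rel A ℓ}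
  (sto : IsStrictTotalOrder _≡_ _<_) →
  let open Tableaux sto in
  (T : Tab) → IsTableau T →
  (x y : A) → x ≢ y → NotLabel x T → NotLabel y T →
  (S : Box) (s : A) (preC postC preR postR : List (Box × A)) →
  proj₁ (colTrail x T) ≡ preC ++ ((S , s) ∷ postC) →
  proj₁ (rowTrail T y) ≡ preR ++ ((S , s) ∷ postR) →
  (∀ D → D ∈ trailBoxes (colTrail x T) → D ∈ trailBoxes (rowTrail T y) → D ≡ S) →
  let B = nextBox postC (proj₂ (colTrail x T))
      J = nextBox postR (proj₂ (rowTrail T y))
      a = prevLabel x preC
      i = prevLabel y preR
      U = rowInsert (colInsert x T) y
  in
  ((i < a → lab U S ≡ just i × lab U B ≡ just s × lab U J ≡ just a) ×
   (a < i → lab U S ≡ just a × lab U B ≡ just i × lab U J ≡ just s)) ×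
  (∀ D → D ≢ S → D ≢ B → D ≢ J →
    (D ∉ trailBoxes (colTrail x T) → D ∉ trailBoxes (rowTrail T y) → lab U D ≡ lab T D) ×
    (∀ v → (D , v) ∈ slide x (colTrail x T) → lab U D ≡ just v) ×
    (∀ v → (D , v) ∈ slide y (rowTrail T y) → lab U D ≡ just v))
proposition9 sto T isT x y x≢y x∉T y∉T S s preC postC preR postR colTrail≡ rowTrail≡ meet-at-S =
  (labels-when-i<a , labels-when-a<i) , other-boxes
  where
  open InsertionTrails.Crossing sto T isT x y x≢y x∉T y∉T S s preC postC preR postR colTrail≡ rowTrail≡ meet-at-S
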